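{- Let $l,m,n$ be positive integers with $l\le m$, and let $k$ be a positive integer. Define \[ \psi(l,m,n)=\#\{X\subseteq [l,m]:\ l\in X \text{ and } \gcd(X,n)=1\},\qquad \psi_k(l,m,n)=\#\{X\subseteq [l,m]:\ l\in X,\ \#X=k, \text{ and } \gcd(X,n)=1\}. \] Then \[ \psi(l,m,n)=\sum_{d\mid \gcd(l,n)}\mu(d)\,2^{\lfloor m/d\rfloor-l/d},\qquad \psi_k(l,m,n)=\sum_{d\mid \gcd(l,n)}\mu(d)\binom{\lfloor m/d\rfloor-l/d}{k-1}. \]
   Context: $[l,m]=\{l,l+1,\ldots,m\}$. For a finite nonempty set $X$ of positive integers, $\gcd(X,n)$ denotes the greatest common divisor of all elements of $X\cup\{n\}$. $\mu$ is the Möbius function. -}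

module Defs where

open import Data.Nat using (ℕ; zero; suc; _+_; _*_; _∸_; _^_; _≤_; NonZero; _≟_)
open import Data.Nat.Divisibility using (_∣_; _∣?_)
open import Data.Nat.GCD using (gcd)
open import Data.Nat.Primality using (prime?)
open import Data.Nat.Combinatorics using (_C_)
open import Data.Nat.DivMod using (_/_)
open import Data.Integer using (ℤ; +_; -_)
open import Data.List using (List; []; _∷_; [_]; _++_; map; foldr; filter; length; upTo)
open import Data.List.Membership.DecPropositional _≟_ using (_∈?_)
open import Relation.Nullary using (¬?; does)
open import Data.Bool using (if_then_else_)
open import Data.List.Relation.Unary.All using (all?)
open import Relation.Nullary.Decidable using (_×-dec_)

interval : ℕ → ℕ → List ℕ
interval l m = map (λ i → l + i) (upTo (suc m ∸ l))

-- all subsets of a list (as sublists); for a duplicate-free list each subset occurs once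
subsets : List ℕ → List (List ℕ)
subsets [] = [ [] ]
subsets (x ∷ xs) = subsets xs ++ map (x ∷_) (subsets xs)

gcdSet : List ℕ → ℕ → ℕ
gcdSet X n = foldr gcd n X

ψ : ℕ → ℕ → ℕ → ℕ
ψ l m n = length (filter (λ X → (l ∈? X) ×-dec (gcdSet X n ≟ 1)) (subsets (interval l m)))

ψₖ : ℕ → ℕ → ℕ → ℕ → ℕ
ψₖ k l m n = length (filter (λ X → (l ∈? X) ×-dec ((length X ≟ k) ×-dec (gcdSet X n ≟ 1)))
                            (subsets (interval l m)))

signPow : ℕ → ℤ
signPow zero = + 1
signPow (suc j) = - signPow j

-- Möbius function: μ(d) = 0 if p² ∣ d for some prime p (equivalently some i ≥ 2 with i² ∣ d),
-- otherwise (-1)^(number of distinct prime divisors of d).  (μ(1) = 1.)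
μ : ℕ → ℤ
μ d = if does (all? (λ i → ¬? ((i * i) ∣? d)) (interval 2 d))
      then signPow (length (filter (λ p → prime? p ×-dec (p ∣? d)) (interval 2 d)))
      else + 0

sumDivisors : ℕ → ((d : ℕ) → .{{NonZero d}} → ℤ) → ℤ
sumDivisors g f = foldr (λ i acc → if does (suc i ∣? g) then f (suc i) Data.Integer.+ acc else acc)
                        (+ 0) (upTo g)

{-# OPTIONS --safe #-}
module Submission where

-- Every admissible X is {l} ∪ Y with Y ⊆ (l, m], and gcd(X, n) always divides g = gcd(l, n).  Möbius
-- inversion over the divisors of g, [c = 1] = Σ_{d ∣ g} μ(d) [d ∣ c] for c ∣ g, therefore replaces the
-- condition gcd(X, n) = 1 by the conditions d ∣ gcd(X, n), i.e. "Y consists of multiples of d".  As d ∣ l,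
-- the interval (l, m] contains exactly ⌊m/d⌋ − l/d multiples of d, which leaves 2^(⌊m/d⌋ − l/d) choices of Y,
-- or binomial(⌊m/d⌋ − l/d, k − 1) choices of size k − 1.  The identity Σ_{d ∣ c} μ(d) = [c = 1] behind the
-- inversion holds because, for a prime p ∣ c, the divisors d of c with p ∤ d cancel against their multiples
-- d p (μ(d p) = −μ(d)), while the remaining divisors are divisible by p² and have μ = 0.

open import Defs
open import Level using (0ℓ)
open import Data.Bool using (Bool; true; false; if_then_else_; _∧_)
open import Data.Bool.Properties using (if-float; if-eta; if-cong; if-swap-then; ∧-zeroʳ)
open import Data.Integer using (ℤ; +_; -_; _+_; _*_)
import Data.Integer.Properties as ℤₚ
open import Data.Integer.Tactic.RingSolver using (solve-∀)
open import Data.Nat as ℕ using (ℕ; zero; suc; _≤_; _<_; _∸_; _^_; z≤n; s≤s; z<s; s<s; NonZero)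
import Data.Nat.Properties as ℕₚ
open import Data.Nat.Combinatorics using (_C_; nCk+nC[k+1]≡[n+1]C[k+1])
open import Data.Nat.Coprimality using (Coprime; coprime-divisor)
open import Data.Nat.Divisibility
open import Data.Nat.DivMod using (_/_; _%_; m≡m%n+[m/n]*n; m%n<n; m/n*n≡m; [m∸n*o]/o≡m/o∸n)
open import Data.Nat.GCD using (gcd; gcd[m,n]∣m; gcd[m,n]∣n; gcd-greatest; gcd[m,n]≢0)
open import Data.Nat.ListAction using (product)
open import Data.Nat.Primality
open import Data.Nat.Primality.Factorisation using (factorise)
open import Data.List using (List; []; _∷_; _++_; map; applyUpTo; filter; length; foldr)
open import Data.List.Membership.DecPropositional ℕₚ._≟_ using (_∈?_)
open import Data.List.Membership.Propositional using (_∈_)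
open import Data.List.Membership.Propositional.Properties using (∈-map⁺; ∈-map⁻; ∈-upTo⁺; ∈-upTo⁻)
open import Data.List.Relation.Unary.All as All using (All; []; _∷_; all?)
open import Data.List.Relation.Unary.All.Properties using (applyUpTo⁺₂)
open import Data.List.Relation.Unary.Any using (here; there)
open import Data.Product using (_×_; _,_; ∃-syntax; proj₁; proj₂)
open import Data.Sum using (inj₁; inj₂; reduce)
open import Function using (_∘_; _⇔_; mk⇔; Equivalence)
open import Relation.Binary.PropositionalEquality
open import Relation.Nullary using (¬_; Dec; yes; no; does; ¬?; contradiction)
open import Relation.Nullary.Decidable using (dec-true; dec-false; does-⇔; _×-dec_)
open import Relation.Unary using (Pred; Decidable)

open ≡-Reasoning

-- Divisibility and primes

∣+⇔∣ : ∀ {d m n} → d ∣ m → (d ∣ m ℕ.+ n ⇔ d ∣ n)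
∣+⇔∣ d∣m = mk⇔ (λ d∣m+n → ∣m+n∣m⇒∣n d∣m+n d∣m) (∣m∣n⇒∣m+n d∣m)

∣-nonZero : ∀ {m n} → .{{NonZero n}} → m ∣ n → NonZero m
∣-nonZero (divides q refl) = ℕₚ.m*n≢0⇒n≢0 q

prime⇒≥2 : ∀ {p} → Prime p → 2 ≤ p
prime⇒≥2 {p} pp = ℕ.nonTrivial⇒n>1 p {{prime⇒nonTrivial pp}}

prime∣prime⇒≡ : ∀ {p q} → Prime p → Prime q → q ∣ p → q ≡ p
prime∣prime⇒≡ pp pq q∣p with prime⇒irreducible pp q∣p
... | inj₁ refl = contradiction pq ¬prime[1]
... | inj₂ q≡p  = q≡p

prime∤⇒coprime : ∀ {p a} → Prime p → ¬ p ∣ a → Coprime a p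
prime∤⇒coprime pp p∤a (i∣a , i∣p) with prime⇒irreducible pp i∣p
... | inj₁ i≡1 = i≡1
... | inj₂ refl = contradiction i∣a p∤a

∃primeDivisor : ∀ {n} → 2 ≤ n → ∃[ p ] Prime p × p ∣ n
∃primeDivisor {n@(suc _)} 2≤n with factorise n
... | record { factors = [] ; isFactorisation = n≡1 } = contradiction (sym n≡1) (ℕₚ.<⇒≢ 2≤n)
... | record { factors = p ∷ ps ; isFactorisation = n≡p*ps ; factorsPrime = pp ∷ _ } =
  p , pp , divides (product ps) (trans n≡p*ps (ℕₚ.*-comm p (product ps)))

-- Finite sums

∑< : ℕ → (ℕ → ℤ) → ℤ
∑< zero    f = + 0
∑< (suc N) f = f 0 + ∑< N (f ∘ suc)

infix 7 ∑<
syntax ∑< N (λ i → e) = ∑[ i < N ] e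

∑-cong : ∀ N {f g : ℕ → ℤ} → (∀ i → i < N → f i ≡ g i) → ∑< N f ≡ ∑< N g
∑-cong zero    f≗g = refl
∑-cong (suc N) f≗g = cong₂ _+_ (f≗g 0 z<s) (∑-cong N (λ i i<N → f≗g (suc i) (s<s i<N)))

∑-zero : ∀ N {f : ℕ → ℤ} → (∀ i → i < N → f i ≡ + 0) → ∑< N f ≡ + 0
∑-zero zero    f≗0 = refl
∑-zero (suc N) f≗0 = cong₂ _+_ (f≗0 0 z<s) (∑-zero N (λ i i<N → f≗0 (suc i) (s<s i<N)))

∑-+ : ∀ N (f g : ℕ → ℤ) → ∑[ i < N ] (f i + g i) ≡ ∑< N f + ∑< N g
∑-+ zero    f g = refl
∑-+ (suc N) f g = trans (cong (_+_ (f 0 + g 0)) (∑-+ N _ _)) (interchange (f 0) (g 0) _ _)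
  where
  interchange : ∀ a b c d → (a + b) + (c + d) ≡ (a + c) + (b + d)
  interchange = solve-∀

∑-neg : ∀ N (f : ℕ → ℤ) → ∑[ i < N ] (- f i) ≡ - ∑< N f
∑-neg zero    f = refl
∑-neg (suc N) f = trans (cong (_+_ (- f 0)) (∑-neg N _)) (sym (ℤₚ.neg-distrib-+ (f 0) _))

∑-split : ∀ a b (f : ℕ → ℤ) → ∑< (a ℕ.+ b) f ≡ ∑< a f + ∑[ i < b ] f (a ℕ.+ i)
∑-split zero    b f = sym (ℤₚ.+-identityˡ _)
∑-split (suc a) b f = trans (cong (_+_ (f 0)) (∑-split a b _)) (sym (ℤₚ.+-assoc (f 0) _ _))

∑-last : ∀ N (f : ℕ → ℤ) → ∑< (suc N) f ≡ ∑< N f + f N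
∑-last zero    f = trans (ℤₚ.+-identityʳ (f 0)) (sym (ℤₚ.+-identityˡ (f 0)))
∑-last (suc N) f = trans (cong (_+_ (f 0)) (∑-last N _)) (sym (ℤₚ.+-assoc (f 0) _ _))

∑-extend : ∀ {N N'} (f : ℕ → ℤ) → N ≤ N' → (∀ i → N ≤ i → i < N' → f i ≡ + 0) → ∑< N' f ≡ ∑< N f
∑-extend {N} {N'} f N≤N' f≗0 = begin
  ∑< N' f                                ≡⟨ cong (λ M → ∑< M f) (ℕₚ.m+[n∸m]≡n N≤N') ⟨
  ∑< (N ℕ.+ (N' ∸ N)) f                  ≡⟨ ∑-split N (N' ∸ N) f ⟩
  ∑< N f + ∑[ i < N' ∸ N ] f (N ℕ.+ i)  ≡⟨ cong (_+_ (∑< N f)) (∑-zero (N' ∸ N) tail≗0) ⟩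
  ∑< N f + + 0                           ≡⟨ ℤₚ.+-identityʳ _ ⟩
  ∑< N f                                 ∎
  where
  tail≗0 : ∀ i → i < N' ∸ N → f (N ℕ.+ i) ≡ + 0
  tail≗0 i i<N'∸N = f≗0 (N ℕ.+ i) (ℕₚ.m≤m+n N i)
    (subst (N ℕ.+ i <_) (ℕₚ.m+[n∸m]≡n N≤N') (ℕₚ.+-monoʳ-< N i<N'∸N))

∑-const : ∀ N → ∑[ i < N ] + 1 ≡ + N
∑-const zero    = refl
∑-const (suc N) = cong (_+_ (+ 1)) (∑-const N)

∑-multiples : ∀ K d .{{_ : NonZero d}} (H : ℕ → ℤ) →
              ∑[ i < K ℕ.* d ] (if does (d ∣? suc i) then H (suc i) else + 0) ≡ ∑[ j < K ] H (suc j ℕ.* d)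
∑-multiples zero    d H = refl
∑-multiples (suc K) d@(suc d') H = begin
  ∑< (d ℕ.+ K ℕ.* d) h                  ≡⟨ ∑-split d (K ℕ.* d) h ⟩
  ∑< d h + ∑[ i < K ℕ.* d ] h (d ℕ.+ i)  ≡⟨ cong₂ _+_ first-block (∑-cong (K ℕ.* d) (λ i _ → shift i)) ⟩
  H (d ℕ.+ 0) + ∑[ i < K ℕ.* d ] (if does (d ∣? suc i) then H (d ℕ.+ suc i) else + 0)
    ≡⟨ cong (_+_ (H (d ℕ.+ 0))) (∑-multiples K d (H ∘ (d ℕ.+_))) ⟩
  H (d ℕ.+ 0) + ∑[ j < K ] H (d ℕ.+ suc j ℕ.* d) ∎
  where
  h : ℕ → ℤ
  h i = if does (d ∣? suc i) then H (suc i) else + 0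
  first-block : ∑< d h ≡ H (d ℕ.+ 0)
  first-block = begin
    ∑< d h          ≡⟨ ∑-last d' h ⟩
    ∑< d' h + h d'  ≡⟨ cong₂ _+_ (∑-zero d' (λ i i<d' → if-cong (dec-false (d ∣? suc i) (>⇒∤ (s<s i<d')))))
                                 (if-cong (dec-true (d ∣? d) ∣-refl)) ⟩
    + 0 + H d       ≡⟨ ℤₚ.+-identityˡ _ ⟩
    H d             ≡⟨ cong H (ℕₚ.+-identityʳ d) ⟨
    H (d ℕ.+ 0)     ∎
  shift : ∀ i → h (d ℕ.+ i) ≡ (if does (d ∣? suc i) then H (d ℕ.+ suc i) else + 0)
  shift i = begin
    h (d ℕ.+ i)
      ≡⟨ cong (λ x → if does (d ∣? x) then H x else + 0) (ℕₚ.+-suc d i) ⟨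
    (if does (d ∣? d ℕ.+ suc i) then H (d ℕ.+ suc i) else + 0)
      ≡⟨ if-cong (does-⇔ (∣+⇔∣ ∣-refl) (d ∣? d ℕ.+ suc i) (d ∣? suc i)) ⟩
    (if does (d ∣? suc i) then H (d ℕ.+ suc i) else + 0) ∎

χ : Bool → ℤ
χ b = + (if b then 1 else 0)

∑-χ-point : ∀ N k → k < N → ∑[ i < N ] χ (does (i ℕₚ.≟ k)) ≡ + 1
∑-χ-point (suc N) zero    _           = cong (_+_ (+ 1)) (∑-zero N (λ _ _ → refl))
∑-χ-point (suc N) (suc k) (s<s k<N) = trans (ℤₚ.+-identityˡ _) (∑-χ-point N k k<N)

∑-χ-multiples : ∀ N d .{{_ : NonZero d}} → ∑[ i < N ] χ (does (d ∣? suc i)) ≡ + (N / d)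
∑-χ-multiples N d = begin
  ∑< N f                                   ≡⟨ cong (λ M → ∑< M f) N≡Kd+r ⟩
  ∑< (K ℕ.* d ℕ.+ r) f                    ≡⟨ ∑-split (K ℕ.* d) r f ⟩
  ∑< (K ℕ.* d) f + ∑[ i < r ] f (K ℕ.* d ℕ.+ i)
    ≡⟨ cong₂ _+_ (∑-cong (K ℕ.* d) (λ i _ → if-float +_ (does (d ∣? suc i)))) (∑-zero r remainder≗0) ⟩
  ∑[ i < K ℕ.* d ] (if does (d ∣? suc i) then + 1 else + 0) + + 0
    ≡⟨ ℤₚ.+-identityʳ _ ⟩
  ∑[ i < K ℕ.* d ] (if does (d ∣? suc i) then + 1 else + 0)
    ≡⟨ ∑-multiples K d (λ _ → + 1) ⟩
  ∑[ j < K ] + 1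
    ≡⟨ ∑-const K ⟩
  + K ∎
  where
  K = N / d
  r = N % d
  f : ℕ → ℤ
  f i = χ (does (d ∣? suc i))
  N≡Kd+r : N ≡ K ℕ.* d ℕ.+ r
  N≡Kd+r = trans (m≡m%n+[m/n]*n N d) (ℕₚ.+-comm r (K ℕ.* d))
  remainder≗0 : ∀ i → i < r → f (K ℕ.* d ℕ.+ i) ≡ + 0
  remainder≗0 i i<r = cong χ (dec-false (d ∣? suc (K ℕ.* d ℕ.+ i)) λ d∣ →
    let d∣1+i = Equivalence.to (∣+⇔∣ (n∣m*n K)) (subst (d ∣_) (sym (ℕₚ.+-suc (K ℕ.* d) i)) d∣)
    in  ℕₚ.<⇒≱ (ℕₚ.≤-<-trans i<r (m%n<n N d)) (∣⇒≤ d∣1+i))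

-- Counting and integer intervals

count : ∀ {A : Set} → (A → Bool) → List A → ℕ
count b []       = 0
count b (x ∷ xs) = (if b x then 1 else 0) ℕ.+ count b xs

module _ {A : Set} where

  length-filter≡count : ∀ {P : Pred A 0ℓ} (P? : Decidable P) xs →
                        length (filter P? xs) ≡ count (does ∘ P?) xs
  length-filter≡count P? []       = refl
  length-filter≡count P? (x ∷ xs) with does (P? x)
  ... | true  = cong suc (length-filter≡count P? xs)
  ... | false = length-filter≡count P? xs

  count-cong : ∀ {b b' : A → Bool} xs → (∀ x → b x ≡ b' x) → count b xs ≡ count b' xs
  count-cong []       b≗b' = refl
  count-cong (x ∷ xs) b≗b' = cong₂ (λ c n → (if c then 1 else 0) ℕ.+ n) (b≗b' x) (count-cong xs b≗b')

  count-false : ∀ {b : A → Bool} xs → (∀ x → b x ≡ false) → count b xs ≡ 0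
  count-false []       b≗false = refl
  count-false (x ∷ xs) b≗false rewrite b≗false x = count-false xs b≗false

  count-++ : ∀ (b : A → Bool) xs ys → count b (xs ++ ys) ≡ count b xs ℕ.+ count b ys
  count-++ b []       ys = refl
  count-++ b (x ∷ xs) ys = trans (cong (_ ℕ.+_) (count-++ b xs ys)) (sym (ℕₚ.+-assoc (if b x then 1 else 0) _ _))

  count-map : ∀ {B : Set} (b : B → Bool) (f : A → B) xs → count b (map f xs) ≡ count (b ∘ f) xs
  count-map b f []       = refl
  count-map b f (x ∷ xs) = cong (_ ℕ.+_) (count-map b f xs)

count-applyUpTo : ∀ (b : ℕ → Bool) f N → + count b (applyUpTo f N) ≡ ∑[ i < N ] χ (b (f i))
count-applyUpTo b f zero    = refl
count-applyUpTo b f (suc N) = cong (_+_ (χ (b (f 0)))) (count-applyUpTo b (f ∘ suc) N)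

map-applyUpTo : ∀ {A B : Set} (f : A → B) g N → map f (applyUpTo g N) ≡ applyUpTo (f ∘ g) N
map-applyUpTo f g zero    = refl
map-applyUpTo f g (suc N) = cong (f (g 0) ∷_) (map-applyUpTo f (g ∘ suc) N)

i<1+b∸a⇒a+i≤b : ∀ a b {i} → i < suc b ∸ a → a ℕ.+ i ≤ b
i<1+b∸a⇒a+i≤b zero          b       (s≤s i≤b) = i≤b
i<1+b∸a⇒a+i≤b (suc a)       (suc b) i<        = s≤s (i<1+b∸a⇒a+i≤b a b i<)
i<1+b∸a⇒a+i≤b (suc zero)    zero    ()
i<1+b∸a⇒a+i≤b (suc (suc a)) zero    ()

interval≡applyUpTo : ∀ a b → interval a b ≡ applyUpTo (a ℕ.+_) (suc b ∸ a)
interval≡applyUpTo a b = map-applyUpTo (a ℕ.+_) (λ i → i) (suc b ∸ a)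

∈-interval⁺ : ∀ {a b x} → a ≤ x → x ≤ b → x ∈ interval a b
∈-interval⁺ {a} {b} a≤x x≤b = subst (_∈ interval a b) (ℕₚ.m+[n∸m]≡n a≤x)
  (∈-map⁺ (a ℕ.+_) (∈-upTo⁺ (ℕₚ.∸-monoˡ-< (s≤s x≤b) a≤x)))

∈-interval⁻ : ∀ {a b x} → x ∈ interval a b → a ≤ x × x ≤ b
∈-interval⁻ {a} {b} x∈ with i , i∈ , refl ← ∈-map⁻ (a ℕ.+_) x∈ =
  ℕₚ.m≤m+n a i , i<1+b∸a⇒a+i≤b a b (∈-upTo⁻ i∈)

length-filter-interval : ∀ {P : Pred ℕ 0ℓ} (P? : Decidable P) a b →
                         + length (filter P? (interval a b)) ≡ ∑[ i < suc b ∸ a ] χ (does (P? (a ℕ.+ i)))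
length-filter-interval P? a b = begin
  + length (filter P? (interval a b))                ≡⟨ cong +_ (length-filter≡count P? (interval a b)) ⟩
  + count (does ∘ P?) (interval a b)                 ≡⟨ cong (+_ ∘ count (does ∘ P?)) (interval≡applyUpTo a b) ⟩
  + count (does ∘ P?) (applyUpTo (a ℕ.+_) (suc b ∸ a)) ≡⟨ count-applyUpTo (does ∘ P?) (a ℕ.+_) (suc b ∸ a) ⟩
  ∑[ i < suc b ∸ a ] χ (does (P? (a ℕ.+ i)))         ∎

intervalAfter : ℕ → ℕ → List ℕ
intervalAfter l m = applyUpTo (λ i → l ℕ.+ suc i) (m ∸ l)

interval≡∷intervalAfter : ∀ {l m} → l ≤ m → interval l m ≡ l ∷ intervalAfter l m
interval≡∷intervalAfter {l} {m} l≤m = begin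
  interval l m                                  ≡⟨ interval≡applyUpTo l m ⟩
  applyUpTo (l ℕ.+_) (suc m ∸ l)                ≡⟨ cong (applyUpTo (l ℕ.+_)) (ℕₚ.+-∸-assoc 1 l≤m) ⟩
  l ℕ.+ 0 ∷ intervalAfter l m                   ≡⟨ cong (_∷ intervalAfter l m) (ℕₚ.+-identityʳ l) ⟩
  l ∷ intervalAfter l m                         ∎

l∉intervalAfter : ∀ l m → All (l ≢_) (intervalAfter l m)
l∉intervalAfter l m = applyUpTo⁺₂ (λ i → l ℕ.+ suc i) (m ∸ l) (λ i → ℕₚ.<⇒≢ (ℕₚ.m<m+n l z<s))

count-multiples-intervalAfter : ∀ {d l} m .{{_ : NonZero d}} → d ∣ l →
                                count (λ x → does (d ∣? x)) (intervalAfter l m) ≡ m / d ∸ l / d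
count-multiples-intervalAfter {d} {l} m d∣l = ℤₚ.+-injective (begin
  + count (λ x → does (d ∣? x)) (intervalAfter l m)
    ≡⟨ count-applyUpTo (λ x → does (d ∣? x)) (λ i → l ℕ.+ suc i) (m ∸ l) ⟩
  ∑[ i < m ∸ l ] χ (does (d ∣? l ℕ.+ suc i))
    ≡⟨ ∑-cong (m ∸ l) (λ i _ → cong χ (does-⇔ (∣+⇔∣ d∣l) (d ∣? l ℕ.+ suc i) (d ∣? suc i))) ⟩
  ∑[ i < m ∸ l ] χ (does (d ∣? suc i))
    ≡⟨ ∑-χ-multiples (m ∸ l) d ⟩
  + ((m ∸ l) / d)
    ≡⟨ cong (λ x → + ((m ∸ x) / d)) (m/n*n≡m d∣l) ⟨
  + ((m ∸ l / d ℕ.* d) / d)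
    ≡⟨ cong +_ ([m∸n*o]/o≡m/o∸n m (l / d) d) ⟩
  + (m / d ∸ l / d) ∎)

-- Divisor sums

if-dec-cong : ∀ {A : Set} (a? : Dec A) {x y : ℤ} → (A → x ≡ y) →
              (if does a? then x else + 0) ≡ (if does a? then y else + 0)
if-dec-cong (yes a) x≡y = x≡y a
if-dec-cong (no _)  x≡y = refl

if-dec-absorb : ∀ {A B : Set} (a? : Dec A) (b? : Dec B) {x : ℤ} → (A → B) →
                (if does b? then (if does a? then x else + 0) else + 0) ≡ (if does a? then x else + 0)
if-dec-absorb (yes a) b? a⇒b = if-cong (dec-true b? (a⇒b a))
if-dec-absorb (no _)  b? a⇒b = if-eta (does b?)

split-if : ∀ b (x : ℤ) → x ≡ (if b then + 0 else x) + (if b then x else + 0)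
split-if true  x = sym (ℤₚ.+-identityˡ x)
split-if false x = sym (ℤₚ.+-identityʳ x)

if≡*χ : ∀ b (x : ℤ) → (if b then x else + 0) ≡ x * χ b
if≡*χ true  x = sym (ℤₚ.*-identityʳ x)
if≡*χ false x = sym (ℤₚ.*-zeroʳ x)

foldr-if-applyUpTo : ∀ (b : ℕ → Bool) (v : ℕ → ℤ) g N →
                     foldr (λ i acc → if b i then v i + acc else acc) (+ 0) (applyUpTo g N)
                     ≡ ∑[ i < N ] (if b (g i) then v (g i) else + 0)
foldr-if-applyUpTo b v g zero    = refl
foldr-if-applyUpTo b v g (suc N) with b (g 0)
... | true  = cong (_+_ (v (g 0))) (foldr-if-applyUpTo b v (g ∘ suc) N)
... | false = trans (foldr-if-applyUpTo b v (g ∘ suc) N) (sym (ℤₚ.+-identityˡ _))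

sumDivisors≡∑ : ∀ g (f : (d : ℕ) → .{{NonZero d}} → ℤ) →
                sumDivisors g f ≡ ∑[ i < g ] (if does (suc i ∣? g) then f (suc i) else + 0)
sumDivisors≡∑ g f = foldr-if-applyUpTo (λ i → does (suc i ∣? g)) (λ i → f (suc i)) (λ i → i) g

sumDivisors-cong : ∀ g (f f' : (d : ℕ) → .{{NonZero d}} → ℤ) →
                   (∀ i → suc i ∣ g → f (suc i) ≡ f' (suc i)) → sumDivisors g f ≡ sumDivisors g f'
sumDivisors-cong g f f' f≗f' = begin
  sumDivisors g f
    ≡⟨ sumDivisors≡∑ g f ⟩
  ∑[ i < g ] (if does (suc i ∣? g) then f (suc i) else + 0)
    ≡⟨ ∑-cong g (λ i _ → if-dec-cong (suc i ∣? g) (f≗f' i)) ⟩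
  ∑[ i < g ] (if does (suc i ∣? g) then f' (suc i) else + 0)
    ≡⟨ sumDivisors≡∑ g f' ⟨
  sumDivisors g f' ∎

sumDivisors-+ : ∀ g (h h' : ℕ → ℤ) →
                sumDivisors g (λ d → h d + h' d) ≡ sumDivisors g (λ d → h d) + sumDivisors g (λ d → h' d)
sumDivisors-+ g h h' = begin
  sumDivisors g (λ d → h d + h' d)                ≡⟨ sumDivisors≡∑ g (λ d → h d + h' d) ⟩
  ∑[ i < g ] (if b i then h (suc i) + h' (suc i) else + 0)
    ≡⟨ ∑-cong g (λ i _ → if-+ (b i)) ⟩
  ∑[ i < g ] ((if b i then h (suc i) else + 0) + (if b i then h' (suc i) else + 0))
    ≡⟨ ∑-+ g _ _ ⟩
  ∑[ i < g ] (if b i then h (suc i) else + 0) + ∑[ i < g ] (if b i then h' (suc i) else + 0)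
    ≡⟨ cong₂ _+_ (sumDivisors≡∑ g (λ d → h d)) (sumDivisors≡∑ g (λ d → h' d)) ⟨
  sumDivisors g (λ d → h d) + sumDivisors g (λ d → h' d) ∎
  where
  b : ℕ → Bool
  b i = does (suc i ∣? g)
  if-+ : ∀ c {x y} → (if c then x + y else + 0) ≡ (if c then x else + 0) + (if c then y else + 0)
  if-+ true  = refl
  if-+ false = refl

sumDivisors-neg : ∀ g (h : ℕ → ℤ) → sumDivisors g (λ d → - h d) ≡ - sumDivisors g (λ d → h d)
sumDivisors-neg g h = begin
  sumDivisors g (λ d → - h d)
    ≡⟨ sumDivisors≡∑ g (λ d → - h d) ⟩
  ∑[ i < g ] (if does (suc i ∣? g) then - h (suc i) else + 0)
    ≡⟨ ∑-cong g (λ i _ → if-float -_ (does (suc i ∣? g))) ⟨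
  ∑[ i < g ] (- (if does (suc i ∣? g) then h (suc i) else + 0))
    ≡⟨ ∑-neg g _ ⟩
  - (∑[ i < g ] (if does (suc i ∣? g) then h (suc i) else + 0))
    ≡⟨ cong -_ (sumDivisors≡∑ g (λ d → h d)) ⟨
  - sumDivisors g (λ d → h d) ∎

sumDivisors-*zero : ∀ g (h : ℕ → ℤ) → sumDivisors g (λ d → h d * + 0) ≡ + 0
sumDivisors-*zero g h = begin
  sumDivisors g (λ d → h d * + 0)
    ≡⟨ sumDivisors-cong g (λ d → h d * + 0) (λ _ → + 0) (λ i _ → ℤₚ.*-zeroʳ (h (suc i))) ⟩
  sumDivisors g (λ _ → + 0)
    ≡⟨ sumDivisors≡∑ g (λ _ → + 0) ⟩
  ∑[ i < g ] (if does (suc i ∣? g) then + 0 else + 0)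
    ≡⟨ ∑-zero g (λ i _ → if-eta (does (suc i ∣? g))) ⟩
  + 0 ∎

sumDivisors-restrict : ∀ {c g} (h : ℕ → ℤ) → .{{NonZero g}} → c ∣ g →
                       sumDivisors g (λ d → if does (d ∣? c) then h d else + 0) ≡ sumDivisors c (λ d → h d)
sumDivisors-restrict {c} {g} h c∣g = begin
  sumDivisors g (λ d → if does (d ∣? c) then h d else + 0)
    ≡⟨ sumDivisors≡∑ g (λ d → if does (d ∣? c) then h d else + 0) ⟩
  ∑[ i < g ] (if does (suc i ∣? g) then term i else + 0)
    ≡⟨ ∑-cong g (λ i _ → if-dec-absorb (suc i ∣? c) (suc i ∣? g) (λ i+1∣c → ∣-trans i+1∣c c∣g)) ⟩
  ∑[ i < g ] term i
    ≡⟨ ∑-extend term (∣⇒≤ c∣g) (λ i c≤i _ → if-cong (dec-false (suc i ∣? c) (>⇒∤ (s≤s c≤i)))) ⟩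
  ∑[ i < c ] term i
    ≡⟨ sumDivisors≡∑ c (λ d → h d) ⟨
  sumDivisors c (λ d → h d) ∎
  where
  instance _ = ∣-nonZero c∣g
  term : ℕ → ℤ
  term i = if does (suc i ∣? c) then h (suc i) else + 0

sumDivisors-coprimeTo : ∀ {p} c' (h : ℕ → ℤ) → Prime p → .{{NonZero c'}} →
                        sumDivisors (c' ℕ.* p) (λ d → if does (p ∣? d) then + 0 else h d)
                        ≡ sumDivisors c' (λ d → if does (p ∣? d) then + 0 else h d)
sumDivisors-coprimeTo {p} c' h pp = begin
  sumDivisors (c' ℕ.* p) (λ d → h' d)
    ≡⟨ sumDivisors-cong (c' ℕ.* p) (λ d → h' d) (λ d → if does (d ∣? c') then h' d else + 0)
                        (λ i i+1∣c'p → divides-c' (suc i) i+1∣c'p) ⟩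
  sumDivisors (c' ℕ.* p) (λ d → if does (d ∣? c') then h' d else + 0)
    ≡⟨ sumDivisors-restrict {c'} h' (m∣m*n p) ⟩
  sumDivisors c' (λ d → h' d) ∎
  where
  instance
    p≢0   = prime⇒nonZero pp
    c'p≢0 = ℕₚ.m*n≢0 c' p
  h' : ℕ → ℤ
  h' d = if does (p ∣? d) then + 0 else h d
  divides-c' : ∀ d → d ∣ c' ℕ.* p → h' d ≡ (if does (d ∣? c') then h' d else + 0)
  divides-c' d d∣c'p with p ∣? d
  ... | yes _  = sym (if-eta (does (d ∣? c')))
  ... | no p∤d = sym (if-cong (dec-true (d ∣? c') d∣c'))
    where
    d∣c' : d ∣ c'
    d∣c' = coprime-divisor (prime∤⇒coprime pp p∤d) (subst (d ∣_) (ℕₚ.*-comm c' p) d∣c'p)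

sumDivisors-multiplesOf : ∀ {p} c' (h : ℕ → ℤ) → .{{NonZero p}} →
                          sumDivisors (c' ℕ.* p) (λ d → if does (p ∣? d) then h d else + 0)
                          ≡ sumDivisors c' (λ j → h (j ℕ.* p))
sumDivisors-multiplesOf {p} c' h = begin
  sumDivisors (c' ℕ.* p) (λ d → if does (p ∣? d) then h d else + 0)
    ≡⟨ sumDivisors≡∑ (c' ℕ.* p) (λ d → if does (p ∣? d) then h d else + 0) ⟩
  ∑[ i < c' ℕ.* p ] (if does (suc i ∣? c' ℕ.* p) then (if does (p ∣? suc i) then h (suc i) else + 0) else + 0)
    ≡⟨ ∑-cong (c' ℕ.* p) (λ i _ → if-swap-then (does (suc i ∣? c' ℕ.* p)) (does (p ∣? suc i))) ⟩
  ∑[ i < c' ℕ.* p ] (if does (p ∣? suc i) then H (suc i) else + 0)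
    ≡⟨ ∑-multiples c' p H ⟩
  ∑[ j < c' ] H (suc j ℕ.* p)
    ≡⟨ ∑-cong c' (λ j _ → if-cong (does-⇔ (mk⇔ (*-cancelʳ-∣ p) (*-monoˡ-∣ p))
                                          (suc j ℕ.* p ∣? c' ℕ.* p) (suc j ∣? c'))) ⟩
  ∑[ j < c' ] (if does (suc j ∣? c') then h (suc j ℕ.* p) else + 0)
    ≡⟨ sumDivisors≡∑ c' (λ j → h (j ℕ.* p)) ⟨
  sumDivisors c' (λ j → h (j ℕ.* p)) ∎
  where
  H : ℕ → ℤ
  H x = if does (x ∣? c' ℕ.* p) then h x else + 0

-- The Möbius function

Squarefree : ℕ → Set
Squarefree d = All (λ i → ¬ (i ℕ.* i) ∣ d) (interval 2 d)

ω : ℕ → ℕ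
ω d = length (filter (λ p → prime? p ×-dec p ∣? d) (interval 2 d))

μ-squarefree : ∀ {d} → Squarefree d → μ d ≡ signPow (ω d)
μ-squarefree {d} sf = if-cong (dec-true (all? (λ i → ¬? ((i ℕ.* i) ∣? d)) (interval 2 d)) sf)

μ-¬squarefree : ∀ {d} → ¬ Squarefree d → μ d ≡ + 0
μ-¬squarefree {d} ¬sf = if-cong (dec-false (all? (λ i → ¬? ((i ℕ.* i) ∣? d)) (interval 2 d)) ¬sf)

squarefree⇒prime²∤ : ∀ {d q} → .{{NonZero d}} → Squarefree d → Prime q → ¬ (q ℕ.* q) ∣ d
squarefree⇒prime²∤ {d} {q} sf pq q²∣d = All.lookup sf q∈[2,d] q²∣d
  where
  q∈[2,d] : q ∈ interval 2 d
  q∈[2,d] = ∈-interval⁺ (prime⇒≥2 pq) (ℕₚ.≤-trans (ℕₚ.m≤m*n q q {{prime⇒nonZero pq}}) (∣⇒≤ q²∣d))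

prime²∤⇒squarefree : ∀ {d} → (∀ {q} → Prime q → ¬ (q ℕ.* q) ∣ d) → Squarefree d
prime²∤⇒squarefree {d} no-prime² = All.tabulate λ x∈ x²∣d →
  let q , pq , q∣x = ∃primeDivisor (proj₁ (∈-interval⁻ {b = d} x∈))
  in  no-prime² pq (∣-trans (*-pres-∣ q∣x q∣x) x²∣d)

squarefree-∣ : ∀ {a b} → .{{NonZero b}} → a ∣ b → Squarefree b → Squarefree a
squarefree-∣ a∣b sf = All.tabulate λ x∈ x²∣a →
  let 2≤x , x≤a = ∈-interval⁻ x∈
  in  All.lookup sf (∈-interval⁺ 2≤x (ℕₚ.≤-trans x≤a (∣⇒≤ a∣b))) (∣-trans x²∣a a∣b)

prime²∣*prime⇒prime²∣ : ∀ {p q e} → Prime p → Prime q → ¬ p ∣ e → (q ℕ.* q) ∣ e ℕ.* p → (q ℕ.* q) ∣ e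
prime²∣*prime⇒prime²∣ {p} {q} {e} pp pq p∤e q²∣ep with q ℕₚ.≟ p
... | yes refl = contradiction (*-cancelʳ-∣ q {{prime⇒nonZero pq}} q²∣ep) p∤e
... | no  q≢p  = coprime-divisor (prime∤⇒coprime pp p∤q²) (subst ((q ℕ.* q) ∣_) (ℕₚ.*-comm e p) q²∣ep)
  where
  p∤q² : ¬ p ∣ q ℕ.* q
  p∤q² p∣q² = q≢p (sym (prime∣prime⇒≡ pq pp (reduce (euclidsLemma q q pp p∣q²))))

squarefree-*prime : ∀ {p e} → Prime p → ¬ p ∣ e → .{{NonZero e}} → Squarefree e → Squarefree (e ℕ.* p)
squarefree-*prime pp p∤e sf =
  prime²∤⇒squarefree (λ pq q²∣ep → squarefree⇒prime²∤ sf pq (prime²∣*prime⇒prime²∣ pp pq p∤e q²∣ep))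

-- The decision q≟p is a parameter so that it can be matched on: does (q ≟ p) itself unfolds to q ≡ᵇ p.
χ-prime∣*prime : ∀ {p e} q → Prime p → ¬ p ∣ e → (q≟p : Dec (q ≡ p)) →
                 χ (does (prime? q ×-dec q ∣? e ℕ.* p)) ≡ χ (does (prime? q ×-dec q ∣? e)) + χ (does q≟p)
χ-prime∣*prime {p} {e} q pp p∤e q≟p with prime? q | q ∣? e | q ∣? e ℕ.* p | q≟p
... | no ¬pq | _      | _       | yes refl = contradiction pp ¬pq
... | no _   | _      | _       | no _     = refl
... | yes _  | yes q∣e | _       | yes refl = contradiction q∣e p∤e
... | yes _  | yes _   | yes _   | no _     = refl
... | yes _  | yes q∣e | no q∤ep | _        = contradiction (∣m⇒∣m*n p q∣e) q∤ep
... | yes _  | no _    | yes _   | yes refl = refl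
... | yes pq | no q∤e  | yes q∣ep | no q≢p  with euclidsLemma e p pq q∣ep
...   | inj₁ q∣e = contradiction q∣e q∤e
...   | inj₂ q∣p = contradiction (prime∣prime⇒≡ pp pq q∣p) q≢p
χ-prime∣*prime {p} {e} q pp p∤e q≟p | yes _ | no _ | no q∤ep | yes refl = contradiction (n∣m*n e) q∤ep
χ-prime∣*prime {p} {e} q pp p∤e q≟p | yes _ | no _ | no _    | no _     = refl

ω-*prime : ∀ {p} e → Prime p → ¬ p ∣ e → .{{NonZero e}} → ω (e ℕ.* p) ≡ suc (ω e)
ω-*prime {p@(suc (suc p''))} e pp p∤e = ℤₚ.+-injective (begin
  + ω (e ℕ.* p)
    ≡⟨ length-filter-interval (λ q → prime? q ×-dec q ∣? e ℕ.* p) 2 (e ℕ.* p) ⟩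
  ∑[ i < N ] χ (does (prime? (2 ℕ.+ i) ×-dec 2 ℕ.+ i ∣? e ℕ.* p))
    ≡⟨ ∑-cong N (λ i _ → χ-prime∣*prime (2 ℕ.+ i) pp p∤e (2 ℕ.+ i ℕₚ.≟ p)) ⟩
  ∑[ i < N ] (T i + χ (does (i ℕₚ.≟ p'')))
    ≡⟨ ∑-+ N T (λ i → χ (does (i ℕₚ.≟ p''))) ⟩
  ∑< N T + ∑[ i < N ] χ (does (i ℕₚ.≟ p''))
    ≡⟨ cong₂ _+_ (∑-extend T (ℕₚ.∸-monoˡ-≤ 2 (s≤s (ℕₚ.m≤m*n e p))) T-beyond-e)
                 (∑-χ-point N p'' (ℕₚ.∸-monoˡ-≤ 1 (ℕₚ.m≤n*m p e))) ⟩
  ∑< (suc e ∸ 2) T + + 1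
    ≡⟨ cong (λ x → x + + 1) (length-filter-interval (λ q → prime? q ×-dec q ∣? e) 2 e) ⟨
  + ω e + + 1
    ≡⟨ ℤₚ.+-comm (+ ω e) (+ 1) ⟩
  + suc (ω e) ∎)
  where
  N = suc (e ℕ.* p) ∸ 2
  T : ℕ → ℤ
  T i = χ (does (prime? (2 ℕ.+ i) ×-dec 2 ℕ.+ i ∣? e))
  T-beyond-e : ∀ i → suc e ∸ 2 ≤ i → i < N → T i ≡ + 0
  T-beyond-e i e-1≤i _ = cong χ (dec-false (prime? (2 ℕ.+ i) ×-dec 2 ℕ.+ i ∣? e) (>⇒∤ e<2+i ∘ proj₂))
    where
    e<2+i : suc e ≤ 2 ℕ.+ i
    e<2+i = ℕₚ.≤-trans (ℕₚ.m≤n+m∸n (suc e) 2) (ℕₚ.+-monoʳ-≤ 2 e-1≤i)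

μ-*prime-coprime : ∀ {p e} → Prime p → ¬ p ∣ e → .{{NonZero e}} → μ (e ℕ.* p) ≡ - μ e
μ-*prime-coprime {p} {e} pp p∤e with all? (λ i → ¬? ((i ℕ.* i) ∣? e)) (interval 2 e)
... | yes sf  = trans (μ-squarefree (squarefree-*prime pp p∤e sf)) (cong signPow (ω-*prime e pp p∤e))
... | no  ¬sf = μ-¬squarefree (¬sf ∘ squarefree-∣ (m∣m*n p))
  where
  instance
    p≢0  = prime⇒nonZero pp
    ep≢0 = ℕₚ.m*n≢0 e p

μ-*prime : ∀ {p} e → Prime p → .{{NonZero e}} → μ (e ℕ.* p) ≡ - (if does (p ∣? e) then + 0 else μ e)
μ-*prime {p} e pp with p ∣? e
... | yes p∣e = μ-¬squarefree (λ sf → squarefree⇒prime²∤ sf pp (*-monoˡ-∣ p p∣e))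
  where
  instance
    p≢0  = prime⇒nonZero pp
    ep≢0 = ℕₚ.m*n≢0 e p
... | no  p∤e = μ-*prime-coprime pp p∤e

sumDivisors-μ-*prime : ∀ {p} c' → Prime p → .{{NonZero c'}} → sumDivisors (c' ℕ.* p) (λ d → μ d) ≡ + 0
sumDivisors-μ-*prime {p} c' pp = begin
  sumDivisors (c' ℕ.* p) (λ d → μ d)
    ≡⟨ sumDivisors-cong (c' ℕ.* p) (λ d → μ d) (λ d → p∤part d + p∣part d)
                        (λ i _ → split-if (does (p ∣? suc i)) (μ (suc i))) ⟩
  sumDivisors (c' ℕ.* p) (λ d → p∤part d + p∣part d)
    ≡⟨ sumDivisors-+ (c' ℕ.* p) p∤part p∣part ⟩
  sumDivisors (c' ℕ.* p) (λ d → p∤part d) + sumDivisors (c' ℕ.* p) (λ d → p∣part d)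
    ≡⟨ cong₂ _+_ (sumDivisors-coprimeTo c' (λ d → μ d) pp) (sumDivisors-multiplesOf c' (λ d → μ d)) ⟩
  S + sumDivisors c' (λ j → μ (j ℕ.* p))
    ≡⟨ cong (_+_ S) (sumDivisors-cong c' (λ j → μ (j ℕ.* p)) (λ j → - p∤part j) (λ i _ → μ-*prime (suc i) pp)) ⟩
  S + sumDivisors c' (λ j → - p∤part j)
    ≡⟨ cong (_+_ S) (sumDivisors-neg c' p∤part) ⟩
  S + - S
    ≡⟨ ℤₚ.+-inverseʳ S ⟩
  + 0 ∎
  where
  instance _ = prime⇒nonZero pp
  p∤part p∣part : ℕ → ℤ
  p∤part d = if does (p ∣? d) then + 0 else μ d
  p∣part d = if does (p ∣? d) then μ d else + 0
  S = sumDivisors c' (λ d → p∤part d)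

sumDivisors-μ : ∀ c → .{{NonZero c}} → sumDivisors c (λ d → μ d) ≡ χ (does (c ℕₚ.≟ 1))
sumDivisors-μ 1 = refl
sumDivisors-μ c@(suc (suc _)) with ∃primeDivisor {c} (s≤s (s≤s z≤n))
... | p , pp , divides zero ()
... | p , pp , divides (suc c') c≡c'p =
  subst (λ n → sumDivisors n (λ d → μ d) ≡ + 0) (sym c≡c'p) (sumDivisors-μ-*prime (suc c') pp)

χ-≡1-möbius : ∀ {g c} (b : Bool) → .{{NonZero g}} → c ∣ g →
              χ (b ∧ does (c ℕₚ.≟ 1)) ≡ sumDivisors g (λ d → μ d * χ (b ∧ does (d ∣? c)))
χ-≡1-möbius {g}     false c∣g = sym (sumDivisors-*zero g (λ d → μ d))
χ-≡1-möbius {g} {c} true  c∣g = begin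
  χ (does (c ℕₚ.≟ 1))
    ≡⟨ sumDivisors-μ c ⟨
  sumDivisors c (λ d → μ d)
    ≡⟨ sumDivisors-restrict (λ d → μ d) c∣g ⟨
  sumDivisors g (λ d → if does (d ∣? c) then μ d else + 0)
    ≡⟨ sumDivisors-cong g (λ d → if does (d ∣? c) then μ d else + 0) (λ d → μ d * χ (does (d ∣? c)))
                          (λ i _ → if≡*χ (does (suc i ∣? c)) (μ (suc i))) ⟩
  sumDivisors g (λ d → μ d * χ (does (d ∣? c))) ∎
  where instance _ = ∣-nonZero c∣g

count-≡1-möbius : ∀ {A : Set} {g} (R : A → Bool) (c : A → ℕ) {xs} → .{{NonZero g}} →
                  All (λ x → c x ∣ g) xs →
                  + count (λ x → R x ∧ does (c x ℕₚ.≟ 1)) xs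
                  ≡ sumDivisors g (λ d → μ d * + count (λ x → R x ∧ does (d ∣? c x)) xs)
count-≡1-möbius {g = g} R c []                     = sym (sumDivisors-*zero g (λ d → μ d))
count-≡1-möbius {g = g} R c {x ∷ xs} (cx∣g ∷ cxs∣g) = begin
  χ (R x ∧ does (c x ℕₚ.≟ 1)) + + count (λ y → R y ∧ does (c y ℕₚ.≟ 1)) xs
    ≡⟨ cong₂ _+_ (χ-≡1-möbius (R x) cx∣g) (count-≡1-möbius R c cxs∣g) ⟩
  sumDivisors g (λ d → atHead d) + sumDivisors g (λ d → onTail d)
    ≡⟨ sumDivisors-+ g atHead onTail ⟨
  sumDivisors g (λ d → atHead d + onTail d)
    ≡⟨ sumDivisors-cong g (λ d → atHead d + onTail d) (λ d → μ d * + count (λ y → R y ∧ does (d ∣? c y)) (x ∷ xs))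
                          (λ i _ → sym (ℤₚ.*-distribˡ-+ (μ (suc i)) _ _)) ⟩
  sumDivisors g (λ d → μ d * + count (λ y → R y ∧ does (d ∣? c y)) (x ∷ xs)) ∎
  where
  atHead onTail : ℕ → ℤ
  atHead d = μ d * χ (R x ∧ does (d ∣? c x))
  onTail d = μ d * + count (λ y → R y ∧ does (d ∣? c y)) xs

-- Subsets of an interval

∈?-∷-≢ : ∀ {l x} Y → l ≢ x → does (l ∈? x ∷ Y) ≡ does (l ∈? Y)
∈?-∷-≢ {l} {x} Y l≢x = does-⇔ (mk⇔ drop-head there) (l ∈? x ∷ Y) (l ∈? Y)
  where
  drop-head : l ∈ x ∷ Y → l ∈ Y
  drop-head (here l≡x)  = contradiction l≡x l≢x
  drop-head (there l∈Y) = l∈Y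

count-subsets-∌ : ∀ {l} xs → All (l ≢_) xs → (Q : List ℕ → Bool) →
                  count (λ X → does (l ∈? X) ∧ Q X) (subsets xs) ≡ 0
count-subsets-∌     []       []            Q = refl
count-subsets-∌ {l} (x ∷ xs) (l≢x ∷ l∉xs) Q = begin
  count b (subsets xs ++ map (x ∷_) (subsets xs))
    ≡⟨ count-++ b (subsets xs) (map (x ∷_) (subsets xs)) ⟩
  count b (subsets xs) ℕ.+ count b (map (x ∷_) (subsets xs))
    ≡⟨ cong₂ ℕ._+_ (count-subsets-∌ xs l∉xs Q) (count-map b (x ∷_) (subsets xs)) ⟩
  count (b ∘ (x ∷_)) (subsets xs)
    ≡⟨ count-cong (subsets xs) (λ Y → cong (_∧ Q (x ∷ Y)) (∈?-∷-≢ Y l≢x)) ⟩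
  count (λ Y → does (l ∈? Y) ∧ Q (x ∷ Y)) (subsets xs)
    ≡⟨ count-subsets-∌ xs l∉xs (Q ∘ (x ∷_)) ⟩
  0 ∎
  where
  b : List ℕ → Bool
  b X = does (l ∈? X) ∧ Q X

count-subsets-∋ : ∀ {l} xs → All (l ≢_) xs → (Q : List ℕ → Bool) →
                  count (λ X → does (l ∈? X) ∧ Q X) (subsets (l ∷ xs)) ≡ count (Q ∘ (l ∷_)) (subsets xs)
count-subsets-∋ {l} xs l∉xs Q = begin
  count b (subsets xs ++ map (l ∷_) (subsets xs))
    ≡⟨ count-++ b (subsets xs) (map (l ∷_) (subsets xs)) ⟩
  count b (subsets xs) ℕ.+ count b (map (l ∷_) (subsets xs))
    ≡⟨ cong₂ ℕ._+_ (count-subsets-∌ xs l∉xs Q) (count-map b (l ∷_) (subsets xs)) ⟩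
  count (b ∘ (l ∷_)) (subsets xs)
    ≡⟨ count-cong (subsets xs) (λ Y → cong (_∧ Q (l ∷ Y)) (dec-true (l ∈? l ∷ Y) (here refl))) ⟩
  count (Q ∘ (l ∷_)) (subsets xs) ∎
  where
  b : List ℕ → Bool
  b X = does (l ∈? X) ∧ Q X

module _ {P : Pred ℕ 0ℓ} (P? : Decidable P) where

  count-subsets-all : ∀ xs → count (does ∘ all? P?) (subsets xs) ≡ 2 ^ count (does ∘ P?) xs
  count-subsets-all []       = refl
  count-subsets-all (x ∷ xs) = begin
    count (does ∘ all? P?) (subsets xs ++ map (x ∷_) (subsets xs))
      ≡⟨ count-++ (does ∘ all? P?) (subsets xs) _ ⟩
    count (does ∘ all? P?) (subsets xs) ℕ.+ count (does ∘ all? P?) (map (x ∷_) (subsets xs))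
      ≡⟨ cong (count (does ∘ all? P?) (subsets xs) ℕ.+_) (count-map (does ∘ all? P?) (x ∷_) (subsets xs)) ⟩
    count (does ∘ all? P?) (subsets xs) ℕ.+ count (λ Y → does (P? x) ∧ does (all? P? Y)) (subsets xs)
      ≡⟨ by-head (P? x) ⟩
    2 ^ count (does ∘ P?) (x ∷ xs) ∎
    where
    c = count (does ∘ P?) xs
    by-head : (Px? : Dec (P x)) →
              count (does ∘ all? P?) (subsets xs) ℕ.+ count (λ Y → does Px? ∧ does (all? P? Y)) (subsets xs)
              ≡ 2 ^ ((if does Px? then 1 else 0) ℕ.+ c)
    by-head (yes _) = trans (cong₂ ℕ._+_ (count-subsets-all xs) (count-subsets-all xs))
                            (cong (2 ^ c ℕ.+_) (sym (ℕₚ.+-identityʳ (2 ^ c))))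
    by-head (no _)  = trans (cong₂ ℕ._+_ (count-subsets-all xs) (count-false (subsets xs) (λ _ → refl)))
                            (ℕₚ.+-identityʳ (2 ^ c))

  count-subsets-length-all : ∀ xs j →
                             count (λ Y → does (length Y ℕₚ.≟ j) ∧ does (all? P? Y)) (subsets xs)
                             ≡ count (does ∘ P?) xs C j
  count-subsets-length-all []       zero    = refl
  count-subsets-length-all []       (suc j) = refl
  count-subsets-length-all (x ∷ xs) j       = begin
    count (b j) (subsets xs ++ map (x ∷_) (subsets xs))
      ≡⟨ count-++ (b j) (subsets xs) _ ⟩
    count (b j) (subsets xs) ℕ.+ count (b j) (map (x ∷_) (subsets xs))
      ≡⟨ cong (count (b j) (subsets xs) ℕ.+_) (count-map (b j) (x ∷_) (subsets xs)) ⟩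
    count (b j) (subsets xs) ℕ.+ count (b′ (P? x) j) (subsets xs)
      ≡⟨ by-head (P? x) j ⟩
    count (does ∘ P?) (x ∷ xs) C j ∎
    where
    c = count (does ∘ P?) xs
    b : ℕ → List ℕ → Bool
    b j Y = does (length Y ℕₚ.≟ j) ∧ does (all? P? Y)
    b′ : Dec (P x) → ℕ → List ℕ → Bool
    b′ Px? j Y = does (suc (length Y) ℕₚ.≟ j) ∧ (does Px? ∧ does (all? P? Y))
    by-head : (Px? : Dec (P x)) → ∀ j →
              count (b j) (subsets xs) ℕ.+ count (b′ Px? j) (subsets xs) ≡ ((if does Px? then 1 else 0) ℕ.+ c) C j
    by-head Px?     zero    = cong₂ ℕ._+_ (count-subsets-length-all xs zero) (count-false (subsets xs) (λ _ → refl))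
    by-head (yes _) (suc j) = begin
      count (b (suc j)) (subsets xs) ℕ.+ count (b j) (subsets xs)
        ≡⟨ cong₂ ℕ._+_ (count-subsets-length-all xs (suc j)) (count-subsets-length-all xs j) ⟩
      c C suc j ℕ.+ c C j
        ≡⟨ ℕₚ.+-comm (c C suc j) (c C j) ⟩
      c C j ℕ.+ c C suc j
        ≡⟨ nCk+nC[k+1]≡[n+1]C[k+1] c j ⟩
      suc c C suc j ∎
    by-head (no _)  (suc j) = begin
      count (b (suc j)) (subsets xs) ℕ.+ count (λ Y → does (length Y ℕₚ.≟ j) ∧ false) (subsets xs)
        ≡⟨ cong₂ ℕ._+_ (count-subsets-length-all xs (suc j))
                       (count-false (subsets xs) (λ Y → ∧-zeroʳ (does (length Y ℕₚ.≟ j)))) ⟩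
      c C suc j ℕ.+ 0
        ≡⟨ ℕₚ.+-identityʳ (c C suc j) ⟩
      c C suc j ∎

count-subsets-multiples : ∀ {d l} m .{{_ : NonZero d}} → d ∣ l →
                          count (does ∘ all? (d ∣?_)) (subsets (intervalAfter l m)) ≡ 2 ^ (m / d ∸ l / d)
count-subsets-multiples {d} {l} m d∣l =
  trans (count-subsets-all (d ∣?_) (intervalAfter l m)) (cong (2 ^_) (count-multiples-intervalAfter m d∣l))

count-subsets-length-multiples : ∀ {d l} m k .{{_ : NonZero d}} → d ∣ l →
                                 count (λ Y → does (length Y ℕₚ.≟ k) ∧ does (all? (d ∣?_) Y))
                                       (subsets (intervalAfter l m))
                                 ≡ (m / d ∸ l / d) C k
count-subsets-length-multiples {d} {l} m k d∣l =
  trans (count-subsets-length-all (d ∣?_) (intervalAfter l m) k) (cong (_C k) (count-multiples-intervalAfter m d∣l))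

gcdSet-∣ʳ : ∀ X n → gcdSet X n ∣ n
gcdSet-∣ʳ []      n = ∣-refl
gcdSet-∣ʳ (x ∷ X) n = ∣-trans (gcd[m,n]∣n x _) (gcdSet-∣ʳ X n)

gcdSet-∣ : ∀ {x} X n → x ∈ X → gcdSet X n ∣ x
gcdSet-∣ (y ∷ X) n (here refl)  = gcd[m,n]∣m y _
gcdSet-∣ (y ∷ X) n (there x∈X) = ∣-trans (gcd[m,n]∣n y _) (gcdSet-∣ X n x∈X)

∣-gcdSet : ∀ {d} X n → All (d ∣_) X → d ∣ n → d ∣ gcdSet X n
∣-gcdSet []      n []            d∣n = d∣n
∣-gcdSet (x ∷ X) n (d∣x ∷ d∣X) d∣n = gcd-greatest d∣x (∣-gcdSet X n d∣X d∣n)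

gcdSet-∷-∣gcd : ∀ l n Y → gcdSet (l ∷ Y) n ∣ gcd l n
gcdSet-∷-∣gcd l n Y = gcd-greatest (gcd[m,n]∣m l _) (∣-trans (gcd[m,n]∣n l _) (gcdSet-∣ʳ Y n))

∣-gcdSet-∷⇔ : ∀ {d l n} Y → d ∣ l → d ∣ n → (d ∣ gcdSet (l ∷ Y) n ⇔ All (d ∣_) Y)
∣-gcdSet-∷⇔ {d} {l} {n} Y d∣l d∣n = mk⇔
  (λ d∣gcd → All.tabulate (λ y∈Y → ∣-trans d∣gcd (∣-trans (gcd[m,n]∣n l _) (gcdSet-∣ Y n y∈Y))))
  (λ d∣Y → gcd-greatest d∣l (∣-gcdSet Y n d∣Y d∣n))

count-subsets-coprime : ∀ {l m} n (R : List ℕ → Bool) (F : (d : ℕ) → .{{NonZero d}} → ℕ) → .{{NonZero l}} → l ≤ m →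
                        (∀ {d} .{{_ : NonZero d}} → d ∣ l →
                           count (λ Y → R (l ∷ Y) ∧ does (all? (d ∣?_) Y)) (subsets (intervalAfter l m)) ≡ F d) →
                        + count (λ X → does (l ∈? X) ∧ (R X ∧ does (gcdSet X n ℕₚ.≟ 1))) (subsets (interval l m))
                        ≡ sumDivisors (gcd l n) (λ d → μ d * + F d)
count-subsets-coprime {l} {m} n R F l≤m count≡F = begin
  + count (λ X → does (l ∈? X) ∧ Q X) (subsets (interval l m))
    ≡⟨ cong (λ xs → + count (λ X → does (l ∈? X) ∧ Q X) (subsets xs)) (interval≡∷intervalAfter l≤m) ⟩
  + count (λ X → does (l ∈? X) ∧ Q X) (subsets (l ∷ after))
    ≡⟨ cong +_ (count-subsets-∋ after (l∉intervalAfter l m) Q) ⟩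
  + count (Q ∘ (l ∷_)) (subsets after)
    ≡⟨ count-≡1-möbius (R ∘ (l ∷_)) (λ Y → gcdSet (l ∷ Y) n) (All.universal (gcdSet-∷-∣gcd l n) (subsets after)) ⟩
  sumDivisors g (λ d → μ d * + count (λ Y → R (l ∷ Y) ∧ does (d ∣? gcdSet (l ∷ Y) n)) (subsets after))
    ≡⟨ sumDivisors-cong g (λ d → μ d * + count (λ Y → R (l ∷ Y) ∧ does (d ∣? gcdSet (l ∷ Y) n)) (subsets after))
                          (λ d → μ d * + F d) (λ i d∣g → cong (λ k → μ (suc i) * + k) (count-all i d∣g)) ⟩
  sumDivisors g (λ d → μ d * + F d) ∎
  where
  g = gcd l n
  after = intervalAfter l m
  instance _ = ℕ.≢-nonZero (gcd[m,n]≢0 l n (inj₁ (ℕ.≢-nonZero⁻¹ l)))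
  Q : List ℕ → Bool
  Q X = R X ∧ does (gcdSet X n ℕₚ.≟ 1)
  count-all : ∀ i → suc i ∣ g → count (λ Y → R (l ∷ Y) ∧ does (suc i ∣? gcdSet (l ∷ Y) n)) (subsets after) ≡ F (suc i)
  count-all i d∣g = trans (count-cong (subsets after) λ Y → cong (R (l ∷ Y) ∧_)
                             (does-⇔ (∣-gcdSet-∷⇔ Y d∣l d∣n) (suc i ∣? gcdSet (l ∷ Y) n) (all? (suc i ∣?_) Y)))
                          (count≡F d∣l)
    where
    d∣l = ∣-trans d∣g (gcd[m,n]∣m l n)
    d∣n = ∣-trans d∣g (gcd[m,n]∣n l n)

lemma2 : (l m n k : ℕ) → 1 ≤ l → l ≤ m → 1 ≤ n → 1 ≤ k →
    (+ ψ l m n ≡ sumDivisors (gcd l n) (λ d → μ d * + (2 ^ ((m / d) ∸ (l / d)))))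
    × (+ ψₖ k l m n ≡ sumDivisors (gcd l n) (λ d → μ d * + (((m / d) ∸ (l / d)) C (k ∸ 1))))
lemma2 l m n (suc k) 0<l l≤m _ _ =
  trans (cong +_ (length-filter≡count _ (subsets (interval l m))))
        (count-subsets-coprime n (λ _ → true) (λ d → 2 ^ (m / d ∸ l / d)) l≤m
                               (count-subsets-multiples m)) ,
  trans (cong +_ (length-filter≡count _ (subsets (interval l m))))
        (count-subsets-coprime n (λ X → does (length X ℕₚ.≟ suc k)) (λ d → (m / d ∸ l / d) C k) l≤m
                               (count-subsets-length-multiples m k))
  where
  instance _ = ℕ.>-nonZero 0<l
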